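{- For every $p,d$, \[ N_{\mathrm{trop}}(p,d) \leq (p (d-1)+1) 2^{d-1} \enspace . \]
   Context: A sign pattern is a $p\times d$ array $(\epsilon_{ij})$ of signs $+$ or $-$. Positions $(i,j)$, $1\le i\le p$, $1\le j\le d$, are viewed as entries of a $p\times d$ matrix ($(1,1)$ top left). An oriented lattice path is a sequence of positions starting at some top node $(1,j)$ and ending at some bottom node $(p,j')$, each step going either one position down or one position to the right; it thus consists of vertical segments and horizontal segments. Such a path is tropically allowed for $(\epsilon_{ij})$ if: (i) every sign on the initial vertical segment, except possibly the bottom one, is $+$; (ii) every sign on the final vertical segment, except possibly the top one, is $+$; (iii) every sign on any other vertical segment, except possibly its top and bottom signs, is $+$; (iv) for every horizontal segment, the pair (sign of leftmost position, sign of rightmost position) is $(+,-)$ or $(-,+)$; (v) once a pair $(-,+)$ occurs for some horizontal segment, the pairs of all horizontal segments below it are also $(-,+)$. $N_{\mathrm{trop}}(p,d)$ denotes the maximal number, over all $p\times d$ sign patterns, of tropically allowed lattice paths. -}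

module Defs where

open import Data.Nat using (ℕ; zero; suc; _<_; _≤_; _∸_)
open import Data.Fin using (Fin; toℕ)
open import Data.List using (List; []; _∷_; length; lookup)
open import Data.List.Relation.Unary.All using (All)
open import Data.Product using (_×_; _,_)
open import Data.Sum using (_⊎_)
open import Data.Unit using (⊤)
open import Relation.Binary.PropositionalEquality using (_≡_)

data Sign : Set where
  plus minus : Sign

-- A p × d sign pattern; rows and columns are 0-indexed here
-- (row 0 = top row, column 0 = leftmost column).
SignPattern : ℕ → ℕ → Set
SignPattern p d = Fin p → Fin d → Sign

-- A "turn" of a lattice path: a horizontal segment lying in row 'row'
-- and ending (on its right) in column 'col'.
record Turn (p d : ℕ) : Set where
  constructor turn
  field
    row : Fin p
    col : Fin d
open Turn public

-- An oriented lattice path, encoded by its maximal segments: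
-- the start column c₀ (of the top node), followed by the list of its
-- horizontal segments (t₁,c₁),…,(tₘ,cₘ) from top to bottom: the k-th
-- horizontal segment lies in row tₖ and goes from column cₖ₋₁ to cₖ.
-- The vertical segments are: column c₀ from row 0 to row t₁, column cₖ
-- from row tₖ to row tₖ₊₁, and column cₘ from row tₘ to row p-1
-- (possibly degenerate, i.e. one single position).
Path : ℕ → ℕ → Set
Path p d = Fin d × List (Turn p d)

ColsIncr : ∀ {p d} → Fin d → List (Turn p d) → Set
ColsIncr c [] = ⊤
ColsIncr c (t ∷ ts) = (toℕ c < toℕ (col t)) × ColsIncr (col t) ts

-- Rows of distinct horizontal segments strictly increase (maximality:
-- two horizontal segments are separated by a vertical move).
RowsIncr : ∀ {p d} → List (Turn p d) → Set
RowsIncr [] = ⊤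
RowsIncr (t ∷ []) = ⊤
RowsIncr (t ∷ t′ ∷ ts) = (toℕ (row t) < toℕ (row t′)) × RowsIncr (t′ ∷ ts)

ValidPath : ∀ {p d} → Path p d → Set
ValidPath {p} (c₀ , ts) = (1 ≤ p) × ColsIncr c₀ ts × RowsIncr ts

record VSeg (d : ℕ) : Set where
  constructor vseg
  field
    vcol : Fin d
    vtop : ℕ
    vbot : ℕ
open VSeg public

record HSeg (p d : ℕ) : Set where
  constructor hseg
  field
    hrow   : Fin p
    hleft  : Fin d
    hright : Fin d
open HSeg public

vsegs : ∀ {p d} → ℕ → Fin d → ℕ → List (Turn p d) → List (VSeg d)
vsegs last c top [] = vseg c top last ∷ []
vsegs last c top (t ∷ ts) = vseg c top (toℕ (row t)) ∷ vsegs last (col t) (toℕ (row t)) ts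

verticalSegments : ∀ {p d} → Path p d → List (VSeg d)
verticalSegments {p} (c₀ , ts) = vsegs (p ∸ 1) c₀ 0 ts

hsegs : ∀ {p d} → Fin d → List (Turn p d) → List (HSeg p d)
hsegs c [] = []
hsegs c (t ∷ ts) = hseg (row t) c (col t) ∷ hsegs (col t) ts

horizontalSegments : ∀ {p d} → Path p d → List (HSeg p d)
horizontalSegments (c₀ , ts) = hsegs c₀ ts

hpair : ∀ {p d} → SignPattern p d → HSeg p d → Sign × Sign
hpair ε h = ε (hrow h) (hleft h) , ε (hrow h) (hright h)

module _ {p d : ℕ} (ε : SignPattern p d) where

  AllButBottomPlus : VSeg d → Set
  AllButBottomPlus s = ∀ (r : Fin p) → vtop s ≤ toℕ r → toℕ r < vbot s → ε r (vcol s) ≡ plus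

  AllButTopPlus : VSeg d → Set
  AllButTopPlus s = ∀ (r : Fin p) → vtop s < toℕ r → toℕ r ≤ vbot s → ε r (vcol s) ≡ plus

  InteriorPlus : VSeg d → Set
  InteriorPlus s = ∀ (r : Fin p) → vtop s < toℕ r → toℕ r < vbot s → ε r (vcol s) ≡ plus

  TropicallyAllowed : Path p d → Set
  TropicallyAllowed π =
      ValidPath π
    × (∀ (k : Fin (length vs)) → toℕ k ≡ 0 → AllButBottomPlus (lookup vs k))
    × (∀ (k : Fin (length vs)) → suc (toℕ k) ≡ length vs → AllButTopPlus (lookup vs k))
    × (∀ (k : Fin (length vs)) → 0 < toℕ k → suc (toℕ k) < length vs → InteriorPlus (lookup vs k))
    × All (λ h → (hpair ε h ≡ (plus , minus)) ⊎ (hpair ε h ≡ (minus , plus))) hs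
    -- (v) once (-,+) occurs, all horizontal segments below are (-,+)
    × (∀ (k k′ : Fin (length hs)) → toℕ k < toℕ k′ →
         hpair ε (lookup hs k) ≡ (minus , plus) → hpair ε (lookup hs k′) ≡ (minus , plus))
    where
      vs = verticalSegments π
      hs = horizontalSegments π

-- A tropically allowed path is determined by its set of columns together with the
-- position of its pivot: the first turn whose right end, or the right end of the next
-- turn, carries +. By (v), every horizontal segment after the pivot is (−,+), so each
-- later turn sits at the first − below the previous turn in the current column; every
-- turn before the pivot ends on −, so it sits at the last − above the next turn in its
-- column. The pivot column exceeds the start column, which leaves p (d − 1) values for
-- the pivot and 2^(d−1) for the remaining columns; one more pivot value accounts for
-- the paths without horizontal segments, whose start column is stored among 2^(d−1) ≥ d
-- values.
module Submission where

open import Defs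
open import Data.Nat using (ℕ; zero; suc; _+_; _*_; _∸_; _^_; _≤_; _<_; z≤n; s≤s)
open import Data.List using (List; []; _∷_; length; lookup; map)
open import Data.List.Relation.Unary.All using (All; []; _∷_)
open import Data.List.Relation.Unary.Unique.Propositional using (Unique)

open import Data.Bool using (Bool; true; false)
open import Data.Empty using (⊥-elim)
open import Data.Fin using (Fin; zero; suc; toℕ; combine; _↑ˡ_; _↑ʳ_)
import Data.Fin as Fin
import Data.Fin.Properties as Fin
open import Data.Fin.Subset using (Subset)
import Data.List.Properties as List
open import Data.List.Membership.Propositional using (_∈_)
open import Data.List.Membership.Propositional.Properties using (∈-lookup; ∈-map⁺)
open import Data.List.Relation.Binary.Subset.Propositional using (_⊆_)
import Data.List.Relation.Unary.All as All
open import Data.List.Relation.Unary.AllPairs using (AllPairs; []; _∷_)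
open import Data.List.Relation.Unary.Any using (here; there)
open import Data.List.Relation.Unary.Linked using (Linked; [-]; _∷_)
open import Data.List.Relation.Unary.Linked.Properties using (Linked⇒AllPairs)
import Data.Nat.Properties as ℕ
open import Data.Product using (_×_; _,_; proj₁; proj₂; uncurry)
open import Data.Sum using (_⊎_; inj₁; inj₂)
open import Data.Unit using (⊤; tt)
open import Data.Vec using (Vec; []; _∷_; tabulate)
import Data.Vec as Vec
open import Data.Vec.Properties using (lookup∘tabulate; insertAt-removeAt)
open import Function using (_∘_)
open import Relation.Binary.Core using (Rel)
open import Relation.Binary.Definitions using (Asymmetric; tri<; tri≈; tri>)
open import Relation.Binary.PropositionalEquality
open import Relation.Nullary using (does; yes; no)
open import Relation.Nullary.Decidable using (dec-true)

lookup⇒All : ∀ {a ℓ} {A : Set a} {P : A → Set ℓ} {xs : List A} →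
  (∀ i → P (lookup xs i)) → All P xs
lookup⇒All {xs = []} _ = []
lookup⇒All {xs = x ∷ xs} p = p zero ∷ lookup⇒All (p ∘ suc)

record Persistent {a ℓ} {A : Set a} (P : A → Set ℓ) (xs : List A) : Set ℓ where
  constructor persistent
  field persists : ∀ i j → i Fin.< j → P (lookup xs i) → P (lookup xs j)

module _ {a ℓ} {A : Set a} {P : A → Set ℓ} {x : A} {xs : List A} where

  Persistent-head : Persistent P (x ∷ xs) → P x → All P xs
  Persistent-head (persistent persists) px = lookup⇒All λ j → persists zero (suc j) (s≤s z≤n) px

  Persistent-tail : Persistent P (x ∷ xs) → Persistent P xs
  Persistent-tail (persistent persists) = persistent λ i j i<j → persists (suc i) (suc j) (s≤s i<j)

module _ {a} {A : Set a} where

  lookup-injective : ∀ {xs : List A} → Unique xs → ∀ {i j} → lookup xs i ≡ lookup xs j → i ≡ j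
  lookup-injective (_ ∷ _) {zero} {zero} _ = refl
  lookup-injective (x∉ ∷ _) {zero} {suc j} eq = ⊥-elim (All.lookup x∉ (∈-lookup j) eq)
  lookup-injective (x∉ ∷ _) {suc i} {zero} eq = ⊥-elim (All.lookup x∉ (∈-lookup i) (sym eq))
  lookup-injective (_ ∷ u) {suc i} {suc j} eq = cong suc (lookup-injective u eq)

  unique-injectiveOn⇒length≤ : ∀ {ℓ} {P : A → Set ℓ} {m} (f : ∀ x → P x → Fin m) →
    (∀ {x y} (px : P x) (py : P y) → f x px ≡ f y py → x ≡ y) →
    ∀ {xs} → Unique xs → All P xs → length xs ≤ m
  unique-injectiveOn⇒length≤ {P = P} f f-inj {xs} u pxs = Fin.injective⇒≤ λ eq →
    lookup-injective u (f-inj (lookupP _) (lookupP _) eq)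
    where
    lookupP : (i : Fin (length xs)) → P (lookup xs i)
    lookupP i = All.lookup pxs (∈-lookup i)

  module _ {ℓ} {_<_ : Rel A ℓ} (<-asym : Asymmetric _<_) where

    AllPairs-⊆-antisym : ∀ {xs ys} → AllPairs _<_ xs → AllPairs _<_ ys →
      xs ⊆ ys → ys ⊆ xs → xs ≡ ys
    AllPairs-⊆-antisym {[]} {[]} _ _ _ _ = refl
    AllPairs-⊆-antisym {[]} {y ∷ _} _ _ _ ys⊆xs with () ← ys⊆xs (here refl)
    AllPairs-⊆-antisym {x ∷ _} {[]} _ _ xs⊆ys _ with () ← xs⊆ys (here refl)
    AllPairs-⊆-antisym {x ∷ xs} {y ∷ ys} (x< ∷ sxs) (y< ∷ sys) xs⊆ys ys⊆xs
      with heads (xs⊆ys (here refl)) (ys⊆xs (here refl))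
      where
      heads : x ∈ y ∷ ys → y ∈ x ∷ xs → x ≡ y
      heads (here x≡y) _ = x≡y
      heads (there _) (here y≡x) = sym y≡x
      heads (there x∈ys) (there y∈xs) = ⊥-elim (<-asym (All.lookup x< y∈xs) (All.lookup y< x∈ys))
    ... | refl = cong (x ∷_)
      (AllPairs-⊆-antisym sxs sys (shrink x< (xs⊆ys ∘ there)) (shrink y< (ys⊆xs ∘ there)))
      where
      shrink : ∀ {us vs} → All (x <_) us → us ⊆ x ∷ vs → us ⊆ vs
      shrink x<us us⊆ z∈us with us⊆ z∈us
      ... | here refl = ⊥-elim (<-asym (All.lookup x<us z∈us) (All.lookup x<us z∈us))
      ... | there z∈vs = z∈vs

removeAt-lookup-injective : ∀ {a} {A : Set a} {n} {xs ys : Vec A (suc n)} i →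
  Vec.lookup xs i ≡ Vec.lookup ys i → Vec.removeAt xs i ≡ Vec.removeAt ys i → xs ≡ ys
removeAt-lookup-injective {xs = xs} {ys} i xᵢ≡yᵢ xs-i≡ys-i = begin
  xs                                                   ≡⟨ insertAt-removeAt xs i ⟨
  Vec.insertAt (Vec.removeAt xs i) i (Vec.lookup xs i) ≡⟨ cong₂ (λ v y → Vec.insertAt v i y)
                                                                xs-i≡ys-i xᵢ≡yᵢ ⟩
  Vec.insertAt (Vec.removeAt ys i) i (Vec.lookup ys i) ≡⟨ insertAt-removeAt ys i ⟩
  ys                                                   ∎
  where open ≡-Reasoning

↑ʳ≢↑ˡ : ∀ m {n} (i : Fin n) (j : Fin m) → m ↑ʳ i ≢ j ↑ˡ n
↑ʳ≢↑ˡ m {n} i j eq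
  with () ← trans (sym (Fin.splitAt-↑ʳ m n i)) (trans (cong (Fin.splitAt m) eq) (Fin.splitAt-↑ˡ m j n))


n<2^n : ∀ n → n < 2 ^ n
n<2^n zero = s≤s z≤n
n<2^n (suc n) = begin-strict
  suc n               ≤⟨ n<2^n n ⟩
  2 ^ n               <⟨ ℕ.m<m+n (2 ^ n) (ℕ.m^n>0 2 n) ⟩
  2 ^ n + 2 ^ n       ≡⟨ cong (2 ^ n +_) (ℕ.+-identityʳ (2 ^ n)) ⟨
  2 ^ suc n           ∎
  where open ℕ.≤-Reasoning


module _ {m : ℕ} where
  open import Data.List.Membership.DecPropositional (Fin._≟_ {m}) using (_∈?_)

  fromList : List (Fin m) → Subset m
  fromList xs = tabulate (λ k → does (k ∈? xs))

  lookup-fromList⁺ : ∀ {k xs} → k ∈ xs → Vec.lookup (fromList xs) k ≡ true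
  lookup-fromList⁺ {k} {xs} k∈xs = trans (lookup∘tabulate _ k) (dec-true (k ∈? xs) k∈xs)

  lookup-fromList⁻ : ∀ {k xs} → Vec.lookup (fromList xs) k ≡ true → k ∈ xs
  lookup-fromList⁻ {k} {xs} eq with k ∈? xs | trans (sym (lookup∘tabulate _ k)) eq
  ... | yes k∈xs | _ = k∈xs
  ... | no _ | ()

  fromList-⊆ : ∀ {xs ys} → fromList xs ≡ fromList ys → xs ⊆ ys
  fromList-⊆ eq k∈xs =
    lookup-fromList⁻ (trans (cong (λ s → Vec.lookup s _) (sym eq)) (lookup-fromList⁺ k∈xs))


fromList-removeAt-injective : ∀ {m} {xs ys : List (Fin (suc m))} {k} → k ∈ xs → k ∈ ys →
  Vec.removeAt (fromList xs) k ≡ Vec.removeAt (fromList ys) k → fromList xs ≡ fromList ys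
fromList-removeAt-injective {k = k} k∈xs k∈ys =
  removeAt-lookup-injective k (trans (lookup-fromList⁺ k∈xs) (sym (lookup-fromList⁺ k∈ys)))

bitIndex : Bool → Fin 2
bitIndex false = zero
bitIndex true = suc zero

bitIndex-injective : ∀ {a b} → bitIndex a ≡ bitIndex b → a ≡ b
bitIndex-injective {false} {false} _ = refl
bitIndex-injective {true} {true} _ = refl

subsetIndex : ∀ {n} → Subset n → Fin (2 ^ n)
subsetIndex [] = zero
subsetIndex (b ∷ s) = combine (bitIndex b) (subsetIndex s)

subsetIndex-injective : ∀ {n} {s t : Subset n} → subsetIndex s ≡ subsetIndex t → s ≡ t
subsetIndex-injective {s = []} {[]} _ = refl
subsetIndex-injective {s = a ∷ s} {b ∷ t} eq
  with Fin.combine-injective (bitIndex a) _ (bitIndex b) _ eq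
... | a≡b , s≡t = cong₂ _∷_ (bitIndex-injective a≡b) (subsetIndex-injective s≡t)

minus≢plus : minus ≢ plus
minus≢plus ()

module Paths {p d : ℕ} (ε : SignPattern p d) where

  rightSign : Turn p d → Sign
  rightSign T = ε (row T) (col T)

  segment : Fin d → Turn p d → HSeg p d
  segment c T = hseg (row T) c (col T)

  IsMinusPlus : HSeg p d → Set
  IsMinusPlus h = hpair ε h ≡ (minus , plus)

  Alternating : HSeg p d → Set
  Alternating h = hpair ε h ≡ (plus , minus) ⊎ IsMinusPlus h

  Alternating⇒IsMinusPlus : ∀ {h} → Alternating h → ε (hrow h) (hright h) ≡ plus →
    IsMinusPlus h
  Alternating⇒IsMinusPlus (inj₁ +-) right≡plus with () ← trans (sym (cong proj₂ +-)) right≡plus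
  Alternating⇒IsMinusPlus (inj₂ -+) _ = -+

  StepDown : Turn p d → Turn p d → Set
  StepDown T T′ =
    row T Fin.< row T′ × InteriorPlus ε (vseg (col T) (toℕ (row T)) (toℕ (row T′)))

  Descent : Turn p d → List (Turn p d) → Set
  Descent T [] = ⊤
  Descent T (T′ ∷ _) = StepDown T T′

  -- Allowedness read turn by turn, for turns whose first horizontal segment starts in
  -- column c.
  data AllowedTurns : Fin d → List (Turn p d) → Set where
    [] : ∀ {c} → AllowedTurns c []
    step : ∀ {c T ts} → c Fin.< col T → Alternating (segment c T) →
           (IsMinusPlus (segment c T) → All IsMinusPlus (hsegs (col T) ts)) →
           Descent T ts → AllowedTurns (col T) ts → AllowedTurns c (T ∷ ts)

  interiorsPlus : ∀ π → TropicallyAllowed ε π → All (InteriorPlus ε) (verticalSegments π)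
  interiorsPlus π (_ , initial , final , middle , _) = lookup⇒All interior
    where
    interior : ∀ k → InteriorPlus ε (lookup (verticalSegments π) k)
    interior k with toℕ k ℕ.≟ 0 | suc (toℕ k) ℕ.≟ length (verticalSegments π)
    ... | yes k≡0 | _        = λ r top<r r<bot → initial k k≡0 r (ℕ.<⇒≤ top<r) r<bot
    ... | no _    | yes last = λ r top<r r<bot → final k last r top<r (ℕ.<⇒≤ r<bot)
    ... | no k≢0  | no ¬last = middle k (ℕ.n≢0⇒n>0 k≢0) (ℕ.≤∧≢⇒< (Fin.toℕ<n k) ¬last)

  RowsIncr-tail : ∀ {T : Turn p d} {ts} → RowsIncr (T ∷ ts) → RowsIncr ts
  RowsIncr-tail {ts = []} _ = tt
  RowsIncr-tail {ts = _ ∷ _} (_ , rows) = rows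

  descent : ∀ {L T} {ts : List (Turn p d)} → RowsIncr (T ∷ ts) →
    All (InteriorPlus ε) (vsegs L (col T) (toℕ (row T)) ts) → Descent T ts
  descent {ts = []} _ _ = tt
  descent {ts = _ ∷ _} (T<T′ , _) (interior ∷ _) = T<T′ , interior

  toAllowedTurns : ∀ {L c top} {ts : List (Turn p d)} → ColsIncr c ts → RowsIncr ts →
    All (InteriorPlus ε) (vsegs L c top ts) → All Alternating (hsegs c ts) →
    Persistent IsMinusPlus (hsegs c ts) → AllowedTurns c ts
  toAllowedTurns {ts = []} _ _ _ _ _ = []
  toAllowedTurns {ts = _ ∷ _} (c<T , cols) rows (_ ∷ interiors) (alt ∷ alts) mp-persists =
    step c<T alt (Persistent-head mp-persists) (descent rows interiors)
      (toAllowedTurns cols (RowsIncr-tail rows) interiors alts (Persistent-tail mp-persists))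

  allowed⇒AllowedTurns : ∀ {c₀ ts} → TropicallyAllowed ε (c₀ , ts) → AllowedTurns c₀ ts
  allowed⇒AllowedTurns allowed@((_ , cols , rows) , _ , _ , _ , alts , persists) =
    toAllowedTurns cols rows (interiorsPlus _ allowed) alts (persistent persists)

  turn-≡ : ∀ {T T′ : Turn p d} → row T ≡ row T′ → col T ≡ col T′ → T ≡ T′
  turn-≡ = cong₂ turn

  turnBelow-unique : ∀ {T T₂ T₂′} → col T₂ ≡ col T₂′ →
    IsMinusPlus (segment (col T) T₂) → IsMinusPlus (segment (col T) T₂′) →
    StepDown T T₂ → StepDown T T₂′ → T₂ ≡ T₂′
  turnBelow-unique {T₂ = turn a _} {turn b _} refl -+ -+′ (T<a , plusAbove-a) (T<b , plusAbove-b)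
    with Fin.<-cmp a b
  ... | tri< a<b _ _ = ⊥-elim (minus≢plus (trans (sym (cong proj₁ -+)) (plusAbove-b a T<a a<b)))
  ... | tri≈ _ refl _ = refl
  ... | tri> _ _ b<a = ⊥-elim (minus≢plus (trans (sym (cong proj₁ -+′)) (plusAbove-a b T<b b<a)))

  turnAbove-unique : ∀ {T T′ T₂} → col T ≡ col T′ →
    rightSign T ≡ minus → rightSign T′ ≡ minus →
    StepDown T T₂ → StepDown T′ T₂ → T ≡ T′
  turnAbove-unique {turn a _} {turn b _} refl a- b- (a<T₂ , plusBelow-a) (b<T₂ , plusBelow-b)
    with Fin.<-cmp a b
  ... | tri< a<b _ _ = ⊥-elim (minus≢plus (trans (sym b-) (plusBelow-a b a<b b<T₂)))
  ... | tri≈ _ refl _ = refl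
  ... | tri> _ _ b<a = ⊥-elim (minus≢plus (trans (sym a-) (plusBelow-b a b<a a<T₂)))

  pivot : Turn p d → List (Turn p d) → Turn p d
  pivot T [] = T
  pivot T (T′ ∷ ts) with rightSign T | rightSign T′
  ... | minus | minus = pivot T′ ts
  ... | _     | _     = T

  PivotStep : Turn p d → Turn p d → List (Turn p d) → Set
  PivotStep T T′ ts =
      (pivot T (T′ ∷ ts) ≡ T × (rightSign T ≡ plus ⊎ rightSign T′ ≡ plus))
    ⊎ (pivot T (T′ ∷ ts) ≡ pivot T′ ts × rightSign T ≡ minus)

  pivotStep : ∀ T T′ ts → PivotStep T T′ ts
  pivotStep T T′ ts with rightSign T | rightSign T′
  ... | plus  | _     = inj₁ (refl , inj₁ refl)
  ... | minus | plus  = inj₁ (refl , inj₂ refl)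
  ... | minus | minus = inj₂ (refl , refl)

  pivot-∈ : ∀ T ts → pivot T ts ∈ T ∷ ts
  pivot-∈ T [] = here refl
  pivot-∈ T (T′ ∷ ts) with pivotStep T T′ ts
  ... | inj₁ (eq , _) = here eq
  ... | inj₂ (eq , _) = there (subst (_∈ T′ ∷ ts) (sym eq) (pivot-∈ T′ ts))

  <-pivot : ∀ {c T ts} → AllowedTurns c (T ∷ ts) → c Fin.< col (pivot T ts)
  <-pivot {ts = []} (step c<T _ _ _ _) = c<T
  <-pivot {T = T} {T′ ∷ ts} (step c<T _ _ _ rest) with pivotStep T T′ ts
  ... | inj₁ (eq , _) = subst (λ P → _ Fin.< col P) (sym eq) c<T
  ... | inj₂ (eq , _) = subst (λ P → _ Fin.< col P) (sym eq) (Fin.<-trans c<T (<-pivot rest))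

  turn≢pivot : ∀ {c T₂ ts T} → AllowedTurns c (T₂ ∷ ts) → col T ≡ c → T ≢ pivot T₂ ts
  turn≢pivot allowed refl T≡pivot = Fin.<-irrefl (cong col T≡pivot) (<-pivot allowed)

  stop⇒IsMinusPlus : ∀ {c T T′ ts} → AllowedTurns c (T ∷ T′ ∷ ts) →
    rightSign T ≡ plus ⊎ rightSign T′ ≡ plus → All IsMinusPlus (hsegs (col T) (T′ ∷ ts))
  stop⇒IsMinusPlus (step _ alt persists _ _) (inj₁ T+) = persists (Alternating⇒IsMinusPlus alt T+)
  stop⇒IsMinusPlus {T = T} {T′} (step _ _ _ _ (step _ alt′ persists′ _ _)) (inj₂ T′+) =
    -+ ∷ persists′ -+
    where
    -+ : IsMinusPlus (segment (col T) T′)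
    -+ = Alternating⇒IsMinusPlus alt′ T′+

  turnsBelow-determined : ∀ {T ts ts′} → map col ts ≡ map col ts′ →
    AllowedTurns (col T) ts → AllowedTurns (col T) ts′ → Descent T ts → Descent T ts′ →
    All IsMinusPlus (hsegs (col T) ts) → All IsMinusPlus (hsegs (col T) ts′) → ts ≡ ts′
  turnsBelow-determined {ts = []} {[]} _ _ _ _ _ _ _ = refl
  turnsBelow-determined {ts = T₂ ∷ ts} {T₂′ ∷ ts′} cols
    (step _ _ _ descent rest) (step _ _ _ descent′ rest′) T↓ T↓′ (-+ ∷ -+s) (-+′ ∷ -+s′)
    with refl ← turnBelow-unique (List.∷-injectiveˡ cols) -+ -+′ T↓ T↓′
    = cong (T₂ ∷_)
        (turnsBelow-determined (List.∷-injectiveʳ cols) rest rest′ descent descent′ -+s -+s′)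

  turns-determined-by-pivot : ∀ {c c′ T T′ ts ts′} → map col (T ∷ ts) ≡ map col (T′ ∷ ts′) →
    pivot T ts ≡ pivot T′ ts′ → AllowedTurns c (T ∷ ts) → AllowedTurns c′ (T′ ∷ ts′) →
    T ∷ ts ≡ T′ ∷ ts′
  turns-determined-by-pivot {ts = []} {[]} _ T≡T′ _ _ = cong (_∷ []) T≡T′
  turns-determined-by-pivot {ts = []} {_ ∷ _} cols _ _ _ with () ← List.∷-injectiveʳ cols
  turns-determined-by-pivot {ts = _ ∷ _} {[]} cols _ _ _ with () ← List.∷-injectiveʳ cols
  turns-determined-by-pivot {T = T} {T′} {T₂ ∷ ts} {T₂′ ∷ ts′} cols pivot≡
    allowed@(step _ _ _ T↓ rest) allowed′@(step _ _ _ T′↓ rest′)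
    with pivotStep T T₂ ts | pivotStep T′ T₂′ ts′
  ... | inj₁ (eq , stops) | inj₁ (eq′ , stops′)
    with refl ← trans (sym eq) (trans pivot≡ eq′) =
    cong (T ∷_) (turnsBelow-determined (List.∷-injectiveʳ cols) rest rest′ T↓ T′↓
                   (stop⇒IsMinusPlus allowed stops) (stop⇒IsMinusPlus allowed′ stops′))
  ... | inj₁ (eq , _) | inj₂ (eq′ , _) =
    ⊥-elim (turn≢pivot rest′ (List.∷-injectiveˡ cols) (trans (sym eq) (trans pivot≡ eq′)))
  ... | inj₂ (eq , _) | inj₁ (eq′ , _) =
    ⊥-elim (turn≢pivot rest (sym (List.∷-injectiveˡ cols))
                       (trans (sym eq′) (trans (sym pivot≡) eq)))
  ... | inj₂ (eq , T-) | inj₂ (eq′ , T′-)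
    with refl ← turns-determined-by-pivot (List.∷-injectiveʳ cols) (trans (sym eq) (trans pivot≡ eq′))
                                          rest rest′ =
    cong (_∷ T₂ ∷ ts) (turnAbove-unique {T₂ = T₂} (List.∷-injectiveˡ cols) T- T′- T↓ T′↓)

  columns : Path p d → List (Fin d)
  columns (c₀ , ts) = c₀ ∷ map col ts

  columns-sorted : ∀ {c ts} → AllowedTurns c ts → AllPairs Fin._<_ (columns (c , ts))
  columns-sorted = Linked⇒AllPairs Fin.<-trans ∘ linked
    where
    linked : ∀ {c ts} → AllowedTurns c ts → Linked Fin._<_ (columns (c , ts))
    linked [] = [-]
    linked (step c<T _ _ _ rest) = c<T ∷ linked rest

  pivot-col-∈ : ∀ c₀ T ts → col (pivot T ts) ∈ columns (c₀ , T ∷ ts)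
  pivot-col-∈ _ T ts = there (∈-map⁺ col (pivot-∈ T ts))

  path-determined : ∀ {c₀ c₀′ T T′ ts ts′} →
    AllowedTurns c₀ (T ∷ ts) → AllowedTurns c₀′ (T′ ∷ ts′) → pivot T ts ≡ pivot T′ ts′ →
    fromList (columns (c₀ , T ∷ ts)) ≡ fromList (columns (c₀′ , T′ ∷ ts′)) →
    (c₀ , T ∷ ts) ≡ (c₀′ , T′ ∷ ts′)
  path-determined {c₀} {c₀′} {T} {T′} {ts} {ts′} allowed allowed′ pivot≡ columns≈ =
    cong₂ _,_ (List.∷-injectiveˡ columns≡)
              (turns-determined-by-pivot (List.∷-injectiveʳ columns≡) pivot≡ allowed allowed′)
    where
    columns≡ : columns (c₀ , T ∷ ts) ≡ columns (c₀′ , T′ ∷ ts′)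
    columns≡ = AllPairs-⊆-antisym Fin.<-asym (columns-sorted allowed) (columns-sorted allowed′)
                 (fromList-⊆ columns≈) (fromList-⊆ (sym columns≈))

module Coding {p n : ℕ} (ε : SignPattern p (suc n)) where
  open Paths ε

  pivot-col≢0 : ∀ {c₀ T ts} → AllowedTurns c₀ (T ∷ ts) → zero ≢ col (pivot T ts)
  pivot-col≢0 allowed 0≡col = ℕ.n≮0 (subst (_ Fin.<_) (sym 0≡col) (<-pivot allowed))

  pivotIndex : ∀ c₀ ts → AllowedTurns c₀ ts → Fin (p * n + 1)
  pivotIndex _ [] _ = p * n ↑ʳ zero
  pivotIndex _ (T ∷ ts) allowed =
    combine (row (pivot T ts)) (Fin.punchOut (pivot-col≢0 allowed)) ↑ˡ 1

  restIndex : Fin (suc n) → List (Turn p (suc n)) → Fin (2 ^ n)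
  restIndex c₀ [] = Fin.inject≤ c₀ (n<2^n n)
  restIndex c₀ (T ∷ ts) =
    subsetIndex (Vec.removeAt (fromList (columns (c₀ , T ∷ ts))) (col (pivot T ts)))

  code : ∀ c₀ ts → AllowedTurns c₀ ts → Fin ((p * n + 1) * 2 ^ n)
  code c₀ ts allowed = combine (pivotIndex c₀ ts allowed) (restIndex c₀ ts)

  turningPath-indices-injective : ∀ {c₀ c₀′ T T′ ts ts′}
    (allowed : AllowedTurns c₀ (T ∷ ts)) (allowed′ : AllowedTurns c₀′ (T′ ∷ ts′)) →
    pivotIndex c₀ (T ∷ ts) allowed ≡ pivotIndex c₀′ (T′ ∷ ts′) allowed′ →
    restIndex c₀ (T ∷ ts) ≡ restIndex c₀′ (T′ ∷ ts′) → (c₀ , T ∷ ts) ≡ (c₀′ , T′ ∷ ts′)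
  turningPath-indices-injective {c₀} {c₀′} {T} {T′} {ts} {ts′} allowed allowed′ pivot≡ rest≡ =
    path-determined allowed allowed′ (turn-≡ (proj₁ rowCol≡) col≡) columns≈
    where
    Pv Pv′ : Turn p (suc n)
    Pv = pivot T ts
    Pv′ = pivot T′ ts′
    rowCol≡ : row Pv ≡ row Pv′
            × Fin.punchOut (pivot-col≢0 allowed) ≡ Fin.punchOut (pivot-col≢0 allowed′)
    rowCol≡ = Fin.combine-injective (row Pv) _ (row Pv′) _ (Fin.↑ˡ-injective 1 _ _ pivot≡)
    col≡ : col Pv ≡ col Pv′
    col≡ = Fin.punchOut-injective (pivot-col≢0 allowed) (pivot-col≢0 allowed′) (proj₂ rowCol≡)
    Pv-col-∈′ : col Pv ∈ columns (c₀′ , T′ ∷ ts′)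
    Pv-col-∈′ = subst (_∈ columns (c₀′ , T′ ∷ ts′)) (sym col≡) (pivot-col-∈ c₀′ T′ ts′)
    columns≈ : fromList (columns (c₀ , T ∷ ts)) ≡ fromList (columns (c₀′ , T′ ∷ ts′))
    columns≈ = fromList-removeAt-injective (pivot-col-∈ c₀ T ts) Pv-col-∈′
      (trans (subsetIndex-injective rest≡)
             (cong (Vec.removeAt (fromList (columns (c₀′ , T′ ∷ ts′)))) (sym col≡)))

  code-injective : ∀ {c₀ c₀′ ts ts′} (allowed : AllowedTurns c₀ ts) (allowed′ : AllowedTurns c₀′ ts′) →
    code c₀ ts allowed ≡ code c₀′ ts′ allowed′ → (c₀ , ts) ≡ (c₀′ , ts′)
  code-injective {c₀} {c₀′} {ts} {ts′} allowed allowed′ eq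
    with Fin.combine-injective (pivotIndex c₀ ts allowed) (restIndex c₀ ts)
                               (pivotIndex c₀′ ts′ allowed′) (restIndex c₀′ ts′) eq
  code-injective {c₀} {c₀′} {[]} {[]} _ _ _ | _ , rest≡ =
    cong (_, []) (Fin.inject≤-injective _ _ c₀ c₀′ rest≡)
  code-injective {ts = []} {_ ∷ _} _ _ _ | pivot≡ , _ = ⊥-elim (↑ʳ≢↑ˡ (p * n) zero _ pivot≡)
  code-injective {ts = _ ∷ _} {[]} _ _ _ | pivot≡ , _ = ⊥-elim (↑ʳ≢↑ˡ (p * n) zero _ (sym pivot≡))
  code-injective {ts = _ ∷ _} {_ ∷ _} allowed allowed′ _ | pivot≡ , rest≡ =
    turningPath-indices-injective allowed allowed′ pivot≡ rest≡

proposition17 : (p d : ℕ) (ε : SignPattern p d) (ps : List (Path p d)) →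
    Unique ps → All (TropicallyAllowed ε) ps →
    length ps ≤ (p * (d ∸ 1) + 1) * 2 ^ (d ∸ 1)
proposition17 p zero ε [] _ _ = z≤n
proposition17 p zero ε ((() , _) ∷ _) _ _
proposition17 p (suc n) ε ps unique allowed =
  unique-injectiveOn⇒length≤ (uncurry code) code-injective unique (All.map allowed⇒AllowedTurns allowed)
  where
  open Paths ε
  open Coding ε
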